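{- Let $q=p$ be a prime and $a\in\mathbb{Z}_+$. Let $m$ be the smallest nonnegative integer with $a\le p^m$, $r_a=(q-1)p^m$, $j_{a,\max}=\lfloor (r_a-a)/(q-1)\rfloor$. For $0\le j\le p^m-a$ let $i_j$ be the unique integer with $0\le i_j<q-1$ and $j+i_jp^m\equiv0\pmod{q-1}$, let $l_j=(j+i_jp^m)/(q-1)$, and let $f_{a,j}=(-1)^j\binom{p^m-a}{j}\in\mathbb{F}_p$. Then for every $j\in\{1,2,\dots,p^m-a\}$, in $\mathbb{F}_p$, $$f_{a,j}=\left\lceil\frac{j+i_jp^m}{j_{a,\max}}\right\rceil^{ -1}\binom{r_a-a}{j+i_jp^m}=c_{a,l_j}.$$
   Context: For $0\le j\le j_{a,\max}$ define $c_{a,j}\in\mathbb{F}_p$ by $c_{a,0}=1$ and, for $0<j\le j_{a,\max}$, $c_{a,j}=\left\lceil \frac{j(q-1)}{j_{a,\max}}\right\rceil^{ -1}\binom{r_a-a}{j(q-1)}$ (the inverse taken in $\mathbb{F}_p$; the ceiling lies in $\{1,\dots,q-1\}$, hence is nonzero in $\mathbb{F}_p$). -}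

module Defs where

open import Data.Nat using (ℕ; zero; suc; _+_; _*_; _∸_; _^_; _/_)
open import Data.Nat.Combinatorics using (_C_)
open import Data.Integer as ℤ using (ℤ; +_)
open import Data.Integer.Divisibility as ℤD using ()

-- Floor / ceiling of n / d for d > 0 (the d = 0 branch is a junk value and
-- never used in the statement, where the divisors are positive).
floorDiv : ℕ → ℕ → ℕ
floorDiv n zero    = 0
floorDiv n (suc d) = n / suc d

ceilDiv : ℕ → ℕ → ℕ
ceilDiv n zero    = 0
ceilDiv n (suc d) = (n + d) / suc d

-- Congruence of integers modulo p, i.e. equality of images in 𝔽_p = ℤ/pℤ.
_≡_[mod_] : ℤ → ℤ → ℕ → Set
x ≡ y [mod p ] = (+ p) ℤD.∣ (x ℤ.- y)

-- Inverse in 𝔽_p of (the class of) x, for p prime and p ∤ x: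
-- by Fermat's little theorem it is represented by x^(p-2).
invMod : ℕ → ℕ → ℕ
invMod p x = x ^ (p ∸ 2)

r : ℕ → ℕ → ℕ
r p m = (p ∸ 1) * p ^ m

jmax : ℕ → ℕ → ℕ → ℕ
jmax p m a = floorDiv (r p m ∸ a) (p ∸ 1)

c : ℕ → ℕ → ℕ → ℕ → ℤ
c p m a zero = + 1
c p m a (suc j') =
  + (invMod p (ceilDiv (suc j' * (p ∸ 1)) (jmax p m a))
      * ((r p m ∸ a) C (suc j' * (p ∸ 1))))

f : ℕ → ℕ → ℕ → ℕ → ℤ
f p m a j = (ℤ.- (+ 1)) ℤ.^ j ℤ.* (+ ((p ^ m ∸ a) C j))

-- Write P = p^m. Then r_a - a = (p-2) P + (P - a) and j + i P have base-P digits
-- (p-2, P-a) and (i, j). The interior binomial coefficients of P vanish mod p, so Lucas'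
-- theorem in base P (a double induction on Pascal's rule) gives
-- binom(r_a - a, j + i P) = binom(p-2, i) binom(P-a, j) mod p, and
-- binom(p-2, i) = (-1)^i (i+1) mod p. The ceiling in the statement equals i + 1, and its
-- inverse (i+1)^(p-2) cancels that factor by Fermat's little theorem, itself a consequence
-- of the Frobenius identity (x+y)^p = x^p + y^p. Finally P = 1 mod p - 1, so p - 1 divides
-- i + j and (-1)^i = (-1)^j mod p. The second congruence is the definition of c_{a,l}
-- unfolded at l (p - 1) = j + i P.
module Submission where

open import Defs
open import Data.Nat using (ℕ; _+_; _*_; _∸_; _^_; _≤_; _<_)
open import Data.Nat.Divisibility using (_∣_)
open import Data.Nat.Primality using (Prime)
open import Data.Nat.Combinatorics using (_C_)
open import Data.Integer using (+_)
open import Data.Product using (_×_)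
open import Relation.Binary.PropositionalEquality using (_≡_)

open import Data.Nat using (zero; suc; _/_; _%_; s≤s; z≤n; NonZero)
open import Data.Nat.Properties
open import Data.Nat.Combinatorics using (nC1≡n; nCn≡1; nCk+nC[k+1]≡[n+1]C[k+1]; k>n⇒nCk≡0)
open import Data.Nat.DivMod using (m≡m%n+[m/n]*n; m%n<n; m/n*n≤m; m<n*o⇒m/o<n; /-monoˡ-≤; m*n/n≡m)
open import Data.Nat.Divisibility using (divides; ∣⇒≤; ∣1⇒≡1; ∣m+n∣m⇒∣n; m∣m*n)
open import Data.Nat.Primality using (euclidsLemma; ¬prime[0]; ¬prime[1])
import Data.Nat.Tactic.RingSolver as ℕ
open import Data.Integer as ℤ using (ℤ; ∣_∣; -1ℤ)
import Data.Integer.Properties as ℤ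
import Data.Integer.Divisibility.Signed as Signed
import Data.Integer.Tactic.RingSolver as ℤ
open import Data.Fin as Fin using (Fin; fromℕ; inject₁)
import Data.Fin.Properties as Fin
open import Data.Product using (∃-syntax; _,_; proj₁; proj₂)
open import Data.Sum using (inj₁; inj₂)
open import Data.Empty using (⊥-elim)
open import Relation.Nullary using (¬_; contradiction)
open import Relation.Binary.PropositionalEquality
  using (refl; sym; trans; cong; cong₂; subst; subst₂; module ≡-Reasoning)
open import Algebra.Bundles using (CommutativeRing)
open import Level using (0ℓ)

[1+k]*[1+n]C[1+k]≡[1+n]*nCk : ∀ n k → suc k * (suc n C suc k) ≡ suc n * (n C k)
[1+k]*[1+n]C[1+k]≡[1+n]*nCk zero    zero    = refl
[1+k]*[1+n]C[1+k]≡[1+n]*nCk zero    (suc k) = *-zeroʳ (suc (suc k))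
[1+k]*[1+n]C[1+k]≡[1+n]*nCk (suc n) zero    =
  trans (*-identityˡ _) (trans (nC1≡n (suc (suc n))) (sym (*-identityʳ _)))
[1+k]*[1+n]C[1+k]≡[1+n]*nCk (suc n) (suc k) = begin
  suc (suc k) * (suc (suc n) C suc (suc k))    ≡⟨ cong (suc (suc k) *_) (nCk+nC[k+1]≡[n+1]C[k+1] (suc n) (suc k)) ⟨
  suc (suc k) * (a + b)                        ≡⟨ regroup a b k ⟩
  a + (suc k * a + suc (suc k) * b)            ≡⟨ cong₂ (λ u v → a + (u + v)) ([1+k]*[1+n]C[1+k]≡[1+n]*nCk n k)
                                                                             ([1+k]*[1+n]C[1+k]≡[1+n]*nCk n (suc k)) ⟩
  a + (suc n * (n C k) + suc n * (n C suc k))  ≡⟨ cong (_+_ a) (*-distribˡ-+ (suc n) (n C k) (n C suc k)) ⟨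
  a + suc n * (n C k + n C suc k)              ≡⟨ cong (λ u → a + suc n * u) (nCk+nC[k+1]≡[n+1]C[k+1] n k) ⟩
  a + suc n * a                                ∎
  where
    open ≡-Reasoning
    a = suc n C suc k
    b = suc n C suc (suc k)
    regroup : ∀ a b k → suc (suc k) * (a + b) ≡ a + (suc k * a + suc (suc k) * b)
    regroup = ℕ.solve-∀

prime∣pCk : ∀ {p k} → Prime p → 0 < k → k < p → p ∣ p C k
prime∣pCk {suc n} {suc k} p-prime _ k<p
  with euclidsLemma (suc k) (suc n C suc k) p-prime
         (divides (n C k) (trans ([1+k]*[1+n]C[1+k]≡[1+n]*nCk n k) (*-comm (suc n) (n C k))))
... | inj₁ p∣k = contradiction (∣⇒≤ p∣k) (<⇒≱ k<p)
... | inj₂ p∣C = p∣C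

k*n≤m<[1+k]*n⇒m/n≡k : ∀ {m n k} .{{_ : NonZero n}} → k * n ≤ m → m < suc k * n → m / n ≡ k
k*n≤m<[1+k]*n⇒m/n≡k {m} {n} {k} k*n≤m m<[1+k]*n = ≤-antisym
  (≤-pred (m<n*o⇒m/o<n m<[1+k]*n))
  (subst (_≤ m / n) (m*n/n≡m k n) (/-monoˡ-≤ n k*n≤m))

ceilDiv≡1+k : ∀ {n d k} → k * d < n → n ≤ suc k * d → ceilDiv n d ≡ suc k
ceilDiv≡1+k {d = zero} k*0<n n≤k*0 = contradiction (<-≤-trans k*0<n n≤k*0) (<-irrefl refl)
ceilDiv≡1+k {n} {suc d} {k} k*d<n n≤[1+k]*d = k*n≤m<[1+k]*n⇒m/n≡k lower upper
  where
    lower : suc k * suc d ≤ n + d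
    lower = subst₂ _≤_ (+-suc d _) (+-comm d n) (+-monoʳ-≤ d k*d<n)
    upper : n + d < suc (suc k) * suc d
    upper = subst (n + d <_) (+-comm (suc k * suc d) (suc d)) (+-mono-≤-< n≤[1+k]*d (n<1+n d))

floorDiv-deficit : ∀ {k P a} → 1 ≤ a → a ≤ suc k * P →
                   ∃[ e ] floorDiv (suc k * P ∸ a) (suc k) + suc e ≡ P × suc k * e < a
floorDiv-deficit {k} {P} {a} 1≤a a≤KP = e , J+[1+e]≡P , K*e<a
  where
    K X J ρ : ℕ
    K = suc k
    X = K * P ∸ a
    J = X / K
    ρ = X % K
    J<P : J < P
    J<P = *-cancelʳ-< K J P (begin-strict
      J * K ≤⟨ m/n*n≤m X K ⟩
      X     <⟨ ∸-monoʳ-< 1≤a a≤KP ⟩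
      K * P ≡⟨ *-comm K P ⟩
      P * K ∎)
      where open ≤-Reasoning
    e : ℕ
    e = proj₁ (m≤n⇒∃[o]m+o≡n J<P)
    J+[1+e]≡P : J + suc e ≡ P
    J+[1+e]≡P = trans (+-suc J e) (proj₂ (m≤n⇒∃[o]m+o≡n J<P))
    K*e+K≡a+ρ : K * e + K ≡ a + ρ
    K*e+K≡a+ρ = +-cancelʳ-≡ (J * K) _ _ (begin
      K * e + K + J * K   ≡⟨ distribute K e J ⟩
      K * (J + suc e)     ≡⟨ cong (K *_) J+[1+e]≡P ⟩
      K * P               ≡⟨ m+[n∸m]≡n a≤KP ⟨
      a + X               ≡⟨ cong (_+_ a) (m≡m%n+[m/n]*n X K) ⟩
      a + (ρ + J * K)     ≡⟨ +-assoc a ρ (J * K) ⟨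
      a + ρ + J * K       ∎)
      where
        open ≡-Reasoning
        distribute : ∀ K e J → K * e + K + J * K ≡ K * (J + suc e)
        distribute = ℕ.solve-∀
    K*e<a : K * e < a
    K*e<a = +-cancelʳ-< K (K * e) a (begin-strict
      K * e + K ≡⟨ K*e+K≡a+ρ ⟩
      a + ρ     <⟨ +-monoʳ-< a (m%n<n X K) ⟩
      a + K     ∎)
      where open ≤-Reasoning

[2+k]^m≡1+[1+k]*Q : ∀ k m → ∃[ Q ] suc (suc k) ^ m ≡ 1 + suc k * Q
[2+k]^m≡1+[1+k]*Q k zero    = 0 , cong suc (sym (*-zeroʳ k))
[2+k]^m≡1+[1+k]*Q k (suc m) =
  let Q , eq = [2+k]^m≡1+[1+k]*Q k m
  in 1 + Q + suc k * Q , trans (cong (suc (suc k) *_) eq) (expand k Q)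
  where
    expand : ∀ k Q → suc (suc k) * (1 + suc k * Q) ≡ 1 + suc k * (1 + Q + suc k * Q)
    expand = ℕ.solve-∀

∣j+i*P⇒∣i+j : ∀ {k P Q i j} → P ≡ 1 + suc k * Q → suc k ∣ j + i * P → suc k ∣ i + j
∣j+i*P⇒∣i+j {k} {Q = Q} {i} {j} refl K∣N =
  ∣m+n∣m⇒∣n (subst (suc k ∣_) (regroup j i (suc k) Q) K∣N) (m∣m*n (i * Q))
  where
    regroup : ∀ j i K Q → j + i * (1 + K * Q) ≡ K * (i * Q) + (i + j)
    regroup = ℕ.solve-∀

complement-residue : ∀ {k P Q i j} → P ≡ 1 + suc k * Q → suc k ∣ i + j → i < suc k → j < P →
                     ∃[ t ] P ≡ j + (suc k * t + suc i)
complement-residue {k} {Q = Q} {i} {j} refl (divides s i+j≡s*K) i<K j<P = t , P≡j+[Kt+1+i]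
  where
    K : ℕ
    K = suc k
    s<1+Q : s < suc Q
    s<1+Q = *-cancelʳ-< K s (suc Q) (begin-strict
      s * K          ≡⟨ i+j≡s*K ⟨
      i + j          <⟨ +-mono-<-≤ i<K (≤-pred j<P) ⟩
      K + K * Q      ≡⟨ *-suc K Q ⟨
      K * suc Q      ≡⟨ *-comm K (suc Q) ⟩
      suc Q * K      ∎)
      where open ≤-Reasoning
    t : ℕ
    t = proj₁ (m≤n⇒∃[o]m+o≡n (≤-pred s<1+Q))
    P≡j+[Kt+1+i] : 1 + K * Q ≡ j + (K * t + suc i)
    P≡j+[Kt+1+i] = begin
      1 + K * Q           ≡⟨ cong (λ Q → 1 + K * Q) (proj₂ (m≤n⇒∃[o]m+o≡n (≤-pred s<1+Q))) ⟨
      1 + K * (s + t)     ≡⟨ expand K s t ⟩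
      1 + s * K + K * t   ≡⟨ cong (λ x → 1 + x + K * t) i+j≡s*K ⟨
      1 + (i + j) + K * t ≡⟨ regroup i j (K * t) ⟩
      j + (K * t + suc i) ∎
      where
        open ≡-Reasoning
        expand : ∀ K s t → 1 + K * (s + t) ≡ 1 + s * K + K * t
        expand = ℕ.solve-∀
        regroup : ∀ i j x → 1 + (i + j) + x ≡ j + (x + suc i)
        regroup = ℕ.solve-∀

[1+i]*J≡N+slack : ∀ {i j J e g w P} → J + suc e ≡ P → P ≡ j + ((suc i + g) * (e + w) + suc i) →
                  suc i * J ≡ j + i * P + (g * (e + w) + suc i * w)
[1+i]*J≡N+slack {i} {j} {J} {e} {g} {w} {P} J+[1+e]≡P P≡j+[[1+i+g][e+w]+1+i] =
  +-cancelʳ-≡ (suc i * suc e) _ _ (begin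
    suc i * J + suc i * suc e                                 ≡⟨ *-distribˡ-+ (suc i) J (suc e) ⟨
    suc i * (J + suc e)                                       ≡⟨ cong (suc i *_) J+[1+e]≡P ⟩
    P + i * P                                                 ≡⟨ cong (_+ i * P) P≡j+[[1+i+g][e+w]+1+i] ⟩
    j + ((suc i + g) * (e + w) + suc i) + i * P               ≡⟨ regroup j i g e w P ⟩
    j + i * P + (g * (e + w) + suc i * w) + suc i * suc e     ∎)
  where
    open ≡-Reasoning
    regroup : ∀ j i g e w P → j + ((suc i + g) * (e + w) + suc i) + i * P
                              ≡ j + i * P + (g * (e + w) + suc i * w) + suc i * suc e
    regroup = ℕ.solve-∀

-- Write J + (e + 1) = P with K e < a, where K = k + 1. Since a ≤ P - j = K t + i + 1 ≤ K (t + 1),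
-- e ≤ t, so (i + 1)(e + 1) ≤ P - j, which is j + i P ≤ (i + 1) J.
ceilDiv-floorDiv : ∀ {k P a j i t} → 1 ≤ a → a ≤ P → 1 ≤ j → j ≤ P ∸ a → i < suc k →
                   P ≡ j + (suc k * t + suc i) →
                   ceilDiv (j + i * P) (floorDiv (suc k * P ∸ a) (suc k)) ≡ suc i
ceilDiv-floorDiv {k} {P} {a} {j} {i} {t} 1≤a a≤P 1≤j j≤P∸a i<K P≡j+[Kt+1+i] =
  ceilDiv≡1+k (begin-strict
    i * J     ≤⟨ *-monoʳ-≤ i J≤P ⟩
    i * P     <⟨ m<n+m (i * P) 1≤j ⟩
    j + i * P ∎)
  (subst (j + i * P ≤_) (sym ([1+i]*J≡N+slack {i} {j} {J} {e} {g} {w} J+[1+e]≡P P≡j+[[1+i+g][e+w]+1+i]))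
    (m≤m+n (j + i * P) _))
  where
    open ≤-Reasoning
    K J : ℕ
    K = suc k
    J = floorDiv (K * P ∸ a) K
    deficit : ∃[ e ] J + suc e ≡ P × K * e < a
    deficit = floorDiv-deficit 1≤a (≤-trans a≤P (m≤m+n P (k * P)))
    e : ℕ
    e = proj₁ deficit
    J+[1+e]≡P : J + suc e ≡ P
    J+[1+e]≡P = proj₁ (proj₂ deficit)
    J≤P : J ≤ P
    J≤P = subst (J ≤_) J+[1+e]≡P (m≤m+n J (suc e))
    e≤t : e ≤ t
    e≤t = ≤-pred (*-cancelˡ-< K e (suc t) (begin-strict
      K * e         <⟨ proj₂ (proj₂ deficit) ⟩
      a             ≤⟨ +-cancelʳ-≤ j a (K * t + suc i) (begin
        a + j               ≡⟨ +-comm a j ⟩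
        j + a               ≤⟨ +-monoˡ-≤ a j≤P∸a ⟩
        P ∸ a + a           ≡⟨ m∸n+n≡m a≤P ⟩
        P                   ≡⟨ P≡j+[Kt+1+i] ⟩
        j + (K * t + suc i) ≡⟨ +-comm j _ ⟩
        K * t + suc i + j   ∎) ⟩
      K * t + suc i ≤⟨ +-monoʳ-≤ (K * t) i<K ⟩
      K * t + K     ≡⟨ +-comm (K * t) K ⟩
      K + K * t     ≡⟨ *-suc K t ⟨
      K * suc t     ∎))
    g w : ℕ
    g = proj₁ (m≤n⇒∃[o]m+o≡n i<K)
    w = proj₁ (m≤n⇒∃[o]m+o≡n e≤t)
    P≡j+[[1+i+g][e+w]+1+i] : P ≡ j + ((suc i + g) * (e + w) + suc i)
    P≡j+[[1+i+g][e+w]+1+i] = subst₂ (λ K t → P ≡ j + (K * t + suc i))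
      (sym (proj₂ (m≤n⇒∃[o]m+o≡n i<K))) (sym (proj₂ (m≤n⇒∃[o]m+o≡n e≤t))) P≡j+[Kt+1+i]

ceilDiv-jmax : ∀ {k m a j i} → 1 ≤ a → a ≤ suc (suc k) ^ m → 1 ≤ j → j ≤ suc (suc k) ^ m ∸ a →
               i < suc k → suc k ∣ j + i * suc (suc k) ^ m →
               ceilDiv (j + i * suc (suc k) ^ m) (jmax (suc (suc k)) m a) ≡ suc i
ceilDiv-jmax {k} {m} {j = j} {i} 1≤a a≤P 1≤j j≤P∸a i<K K∣N =
  ceilDiv-floorDiv 1≤a a≤P 1≤j j≤P∸a i<K
    (proj₂ (complement-residue P≡1+KQ (∣j+i*P⇒∣i+j {i = i} {j} P≡1+KQ K∣N) i<K j<P))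
  where
    P≡1+KQ : suc (suc k) ^ m ≡ 1 + suc k * proj₁ ([2+k]^m≡1+[1+k]*Q k m)
    P≡1+KQ = proj₂ ([2+k]^m≡1+[1+k]*Q k m)
    j<P : j < suc (suc k) ^ m
    j<P = ≤-<-trans j≤P∸a (∸-monoʳ-< 1≤a a≤P)

-- Integers modulo p

pos-^ : ∀ m k → + (m ^ k) ≡ (+ m) ℤ.^ k
pos-^ m zero    = refl
pos-^ m (suc k) = trans (ℤ.pos-* m (m ^ k)) (cong (ℤ._*_ (+ m)) (pos-^ m k))

[-1]^i*[-1]^i≡1 : ∀ i → -1ℤ ℤ.^ i ℤ.* -1ℤ ℤ.^ i ≡ + 1
[-1]^i*[-1]^i≡1 zero    = refl
[-1]^i*[-1]^i≡1 (suc i) = trans (square-neg (-1ℤ ℤ.^ i)) ([-1]^i*[-1]^i≡1 i)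
  where
    square-neg : ∀ x → (-1ℤ ℤ.* x) ℤ.* (-1ℤ ℤ.* x) ≡ x ℤ.* x
    square-neg = ℤ.solve-∀

module ModularIntegers (p : ℕ) where

  -- A record rather than a function, so that x and y can be inferred from x ≈ y.
  infix 4 _≈_
  record _≈_ (x y : ℤ) : Set where
    constructor by-divisibility
    field divides-difference : + p Signed.∣ x ℤ.- y
  open _≈_ public

  private
    transport : ∀ {x y} → x ≡ y → + p Signed.∣ x → + p Signed.∣ y
    transport = subst (+ p Signed.∣_)

    x-x≡0 : ∀ x → + 0 ≡ x ℤ.- x
    x-x≡0 = ℤ.solve-∀
    -[x-y]≡y-x : ∀ x y → ℤ.- (x ℤ.- y) ≡ y ℤ.- x
    -[x-y]≡y-x = ℤ.solve-∀
    [x-y]+[y-z]≡x-z : ∀ x y z → (x ℤ.- y) ℤ.+ (y ℤ.- z) ≡ x ℤ.- z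
    [x-y]+[y-z]≡x-z = ℤ.solve-∀
    [x-y]+[u-v]≡[x+u]-[y+v] : ∀ x y u v → (x ℤ.- y) ℤ.+ (u ℤ.- v) ≡ (x ℤ.+ u) ℤ.- (y ℤ.+ v)
    [x-y]+[u-v]≡[x+u]-[y+v] = ℤ.solve-∀
    [x-y]u+y[u-v]≡xu-yv : ∀ x y u v → (x ℤ.- y) ℤ.* u ℤ.+ y ℤ.* (u ℤ.- v) ≡ x ℤ.* u ℤ.- y ℤ.* v
    [x-y]u+y[u-v]≡xu-yv = ℤ.solve-∀
    -[x-y]≡-x--y : ∀ x y → ℤ.- (x ℤ.- y) ≡ ℤ.- x ℤ.- ℤ.- y
    -[x-y]≡-x--y = ℤ.solve-∀

  ≈-refl : ∀ {x} → x ≈ x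
  ≈-refl {x} = by-divisibility (transport (x-x≡0 x) (Signed.divides (+ 0) refl))

  ≈-reflexive : ∀ {x y} → x ≡ y → x ≈ y
  ≈-reflexive refl = ≈-refl

  ≈-sym : ∀ {x y} → x ≈ y → y ≈ x
  ≈-sym {x} {y} (by-divisibility d) = by-divisibility (transport (-[x-y]≡y-x x y) (Signed.∣m⇒∣-m d))

  ≈-trans : ∀ {x y z} → x ≈ y → y ≈ z → x ≈ z
  ≈-trans {x} {y} {z} (by-divisibility d) (by-divisibility e) =
    by-divisibility (transport ([x-y]+[y-z]≡x-z x y z) (Signed.∣m∣n⇒∣m+n d e))

  +-cong : ∀ {x y u v} → x ≈ y → u ≈ v → x ℤ.+ u ≈ y ℤ.+ v
  +-cong {x} {y} {u} {v} (by-divisibility d) (by-divisibility e) =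
    by-divisibility (transport ([x-y]+[u-v]≡[x+u]-[y+v] x y u v) (Signed.∣m∣n⇒∣m+n d e))

  *-cong : ∀ {x y u v} → x ≈ y → u ≈ v → x ℤ.* u ≈ y ℤ.* v
  *-cong {x} {y} {u} {v} (by-divisibility d) (by-divisibility e) =
    by-divisibility (transport ([x-y]u+y[u-v]≡xu-yv x y u v)
      (Signed.∣m∣n⇒∣m+n (Signed.∣m⇒∣m*n u d) (Signed.∣n⇒∣m*n y e)))

  -‿cong : ∀ {x y} → x ≈ y → ℤ.- x ≈ ℤ.- y
  -‿cong {x} {y} (by-divisibility d) = by-divisibility (transport (-[x-y]≡-x--y x y) (Signed.∣m⇒∣-m d))

  ℤ/p : CommutativeRing 0ℓ 0ℓ
  ℤ/p = record
    { isCommutativeRing = record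
      { isRing = record
        { +-isAbelianGroup = record
          { isGroup = record
            { isMonoid = record
              { isSemigroup = record
                { isMagma = record
                  { isEquivalence = record { refl = ≈-refl ; sym = ≈-sym ; trans = ≈-trans }
                  ; ∙-cong = +-cong }
                ; assoc = λ x y z → ≈-reflexive (ℤ.+-assoc x y z) }
              ; identity = (λ x → ≈-reflexive (ℤ.+-identityˡ x)) , (λ x → ≈-reflexive (ℤ.+-identityʳ x)) }
            ; inverse = (λ x → ≈-reflexive (ℤ.+-inverseˡ x)) , (λ x → ≈-reflexive (ℤ.+-inverseʳ x))
            ; ⁻¹-cong = -‿cong }
          ; comm = λ x y → ≈-reflexive (ℤ.+-comm x y) }
        ; *-cong = *-cong
        ; *-assoc = λ x y z → ≈-reflexive (ℤ.*-assoc x y z)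
        ; *-identity = (λ x → ≈-reflexive (ℤ.*-identityˡ x)) , (λ x → ≈-reflexive (ℤ.*-identityʳ x))
        ; distrib = (λ x y z → ≈-reflexive (ℤ.*-distribˡ-+ x y z))
                  , (λ x y z → ≈-reflexive (ℤ.*-distribʳ-+ x y z)) }
      ; *-comm = λ x y → ≈-reflexive (ℤ.*-comm x y) } }

  open CommutativeRing ℤ/p public using (setoid; +-group; +-monoid; commutativeSemiring; semiring)
  open import Relation.Binary.Reasoning.Setoid setoid
  open import Algebra.Properties.Monoid.Sum +-monoid using (sum; sum-init-last; sum-cong-≋; sum-replicate-zero)
  open import Algebra.Properties.Monoid.Mult +-monoid using () renaming (_×_ to _·_)

  ^-congˡ : ∀ k {x y} → x ≈ y → x ℤ.^ k ≈ y ℤ.^ k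
  ^-congˡ zero    _   = ≈-refl
  ^-congˡ (suc k) x≈y = *-cong x≈y (^-congˡ k x≈y)

  ≈⇒≡[mod] : ∀ {x y} → x ≈ y → x ≡ y [mod p ]
  ≈⇒≡[mod] (by-divisibility d) = Signed.∣⇒∣ᵤ d

  ∣⇒≈0 : ∀ {k} → p ∣ k → + k ≈ + 0
  ∣⇒≈0 {k} p∣k = by-divisibility (transport (sym (ℤ.+-identityʳ (+ k))) (Signed.∣ᵤ⇒∣ p∣k))

  ≈0⇒∣ : ∀ {k} → + k ≈ + 0 → p ∣ k
  ≈0⇒∣ {k} (by-divisibility d) = Signed.∣⇒∣ᵤ (transport (ℤ.+-identityʳ (+ k)) d)

  ·≡* : ∀ k x → k · x ≡ + k ℤ.* x
  ·≡* zero    x = sym (ℤ.*-zeroˡ x)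
  ·≡* (suc k) x = trans (cong (ℤ._+_ x) (·≡* k x)) (sym ([1+y]x≡x+yx x (+ k)))
    where
      [1+y]x≡x+yx : ∀ x y → (+ 1 ℤ.+ y) ℤ.* x ≡ x ℤ.+ y ℤ.* x
      [1+y]x≡x+yx = ℤ.solve-∀

  ∣⇒·≈0 : ∀ {k} → p ∣ k → ∀ x → k · x ≈ + 0
  ∣⇒·≈0 {k} p∣k x = begin
    k · x       ≡⟨ ·≡* k x ⟩
    + k ℤ.* x   ≈⟨ *-cong (∣⇒≈0 p∣k) ≈-refl ⟩
    + 0 ℤ.* x   ≡⟨ ℤ.*-zeroˡ x ⟩
    + 0         ∎

  sum-ends : ∀ {m} (t : Fin (suc (suc m)) → ℤ) → (∀ i → t (Fin.suc (inject₁ i)) ≈ + 0) →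
             sum t ≈ t Fin.zero ℤ.+ t (fromℕ (suc m))
  sum-ends {m} t inner≈0 = begin
    t Fin.zero ℤ.+ sum (λ i → t (Fin.suc i))
      ≈⟨ +-cong (≈-refl {t Fin.zero}) (sum-init-last (λ i → t (Fin.suc i))) ⟩
    t Fin.zero ℤ.+ (sum (λ i → t (Fin.suc (inject₁ i))) ℤ.+ t (fromℕ (suc m)))
      ≈⟨ +-cong (≈-refl {t Fin.zero})
                (+-cong (≈-trans (sum-cong-≋ inner≈0) (sum-replicate-zero m)) (≈-refl {t (fromℕ (suc m))})) ⟩
    t Fin.zero ℤ.+ (+ 0 ℤ.+ t (fromℕ (suc m)))
      ≡⟨ cong (ℤ._+_ (t Fin.zero)) (ℤ.+-identityˡ (t (fromℕ (suc m)))) ⟩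
    t Fin.zero ℤ.+ t (fromℕ (suc m))
      ∎

  -- Lucas' theorem

  InteriorVanishes : ℕ → Set
  InteriorVanishes P = ∀ {t} → 0 < t → t < P → p ∣ P C t

  pascal : ∀ N K → + (suc N C suc K) ≡ + (N C K) ℤ.+ + (N C suc K)
  pascal N K = trans (cong +_ (sym (nCk+nC[k+1]≡[n+1]C[k+1] N K))) (ℤ.pos-+ (N C K) (N C suc K))

  module Digits {P′ : ℕ} where
    P : ℕ
    P = suc P′

    private
      last-digit : ∀ s P′ → suc s * suc P′ + 0 ≡ suc (s * suc P′ + P′)
      last-digit = ℕ.solve-∀

    infix 4 _Matches_
    _Matches_ : ℕ → (ℕ → ℕ → ℤ) → Set
    N Matches g = ∀ s t → t < P → + (N C (s * P + t)) ≈ g s t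

    -- The predecessor of the index s P + t is s P + (t - 1), or (s - 1) P + (P - 1) when
    -- t = 0; Pascal's rule therefore propagates a match from N to N + 1.
    pascal-step : ∀ {N g h} → N Matches g → h 0 0 ≈ + 1 →
                  (∀ s t → suc t < P → h s (suc t) ≈ g s t ℤ.+ g s (suc t)) →
                  (∀ s → h (suc s) 0 ≈ g s P′ ℤ.+ g (suc s) 0) →
                  suc N Matches h
    pascal-step {N} {g} {h} match h00 h-inner h-carry = go
      where
        go : ∀ s t → t < P → + (suc N C (s * P + t)) ≈ h s t
        go zero    zero    _   = ≈-sym h00
        go s       (suc t) t<P = begin
          + (suc N C (s * P + suc t))                      ≡⟨ cong (λ x → + (suc N C x)) (+-suc (s * P) t) ⟩
          + (suc N C suc (s * P + t))                      ≡⟨ pascal N (s * P + t) ⟩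
          + (N C (s * P + t)) ℤ.+ + (N C suc (s * P + t))  ≡⟨ cong (λ x → + (N C (s * P + t)) ℤ.+ + (N C x)) (+-suc (s * P) t) ⟨
          + (N C (s * P + t)) ℤ.+ + (N C (s * P + suc t))  ≈⟨ +-cong (match s t (<-trans (n<1+n t) t<P)) (match s (suc t) t<P) ⟩
          g s t ℤ.+ g s (suc t)                            ≈⟨ ≈-sym (h-inner s t t<P) ⟩
          h s (suc t)                                      ∎
        go (suc s) zero    _   = begin
          + (suc N C (suc s * P + 0))                      ≡⟨ cong (λ x → + (suc N C x)) (last-digit s P′) ⟩
          + (suc N C suc (s * P + P′))                     ≡⟨ pascal N (s * P + P′) ⟩
          + (N C (s * P + P′)) ℤ.+ + (N C suc (s * P + P′)) ≡⟨ cong (λ x → + (N C (s * P + P′)) ℤ.+ + (N C x)) (last-digit s P′) ⟨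
          + (N C (s * P + P′)) ℤ.+ + (N C (suc s * P + 0)) ≈⟨ +-cong (match s P′ ≤-refl) (match (suc s) 0 (s≤s z≤n)) ⟩
          g s P′ ℤ.+ g (suc s) 0                           ≈⟨ ≈-sym (h-carry s) ⟩
          h (suc s) 0                                      ∎

    digits : ℕ → ℕ → ℕ → ℕ → ℤ
    digits u v s t = + (u C s) ℤ.* + (v C t)

    lucas-digits : InteriorVanishes P → ∀ u v → v < P → (u * P + v) Matches digits u v
    lucas-digits interior zero    zero    _   = λ { zero zero _ → ≈-refl ; zero (suc t) _ → ≈-refl ; (suc s) t _ → ≈-refl }
    lucas-digits interior (suc u) zero    _   = subst (_Matches digits (suc u) 0) (sym (last-digit u P′))
      (pascal-step (lucas-digits interior u P′ ≤-refl) ≈-refl inner carry)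
      where
        inner : ∀ s t → suc t < P → digits (suc u) 0 s (suc t) ≈ digits u P′ s t ℤ.+ digits u P′ s (suc t)
        inner s t t<P = ≈-sym (begin
          + (u C s) ℤ.* + (P′ C t) ℤ.+ + (u C s) ℤ.* + (P′ C suc t) ≡⟨ ℤ.*-distribˡ-+ (+ (u C s)) _ _ ⟨
          + (u C s) ℤ.* (+ (P′ C t) ℤ.+ + (P′ C suc t))            ≡⟨ cong (+ (u C s) ℤ.*_) (pascal P′ t) ⟨
          + (u C s) ℤ.* + (P C suc t)                              ≈⟨ *-cong (≈-refl {+ (u C s)}) (∣⇒≈0 (interior (s≤s z≤n) t<P)) ⟩
          + (u C s) ℤ.* + 0                                        ≡⟨ ℤ.*-zeroʳ (+ (u C s)) ⟩
          + 0                                                      ≡⟨ ℤ.*-zeroʳ (+ (suc u C s)) ⟨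
          digits (suc u) 0 s (suc t)                               ∎)
        carry : ∀ s → digits (suc u) 0 (suc s) 0 ≈ digits u P′ s P′ ℤ.+ digits u P′ (suc s) 0
        carry s = begin
          + (suc u C suc s) ℤ.* + 1                                ≡⟨ ℤ.*-identityʳ _ ⟩
          + (suc u C suc s)                                        ≡⟨ pascal u s ⟩
          + (u C s) ℤ.+ + (u C suc s)                              ≡⟨ cong₂ ℤ._+_ (ℤ.*-identityʳ (+ (u C s))) (ℤ.*-identityʳ (+ (u C suc s))) ⟨
          + (u C s) ℤ.* + 1 ℤ.+ + (u C suc s) ℤ.* + 1              ≡⟨ cong (λ x → + (u C s) ℤ.* + x ℤ.+ _) (nCn≡1 P′) ⟨
          + (u C s) ℤ.* + (P′ C P′) ℤ.+ + (u C suc s) ℤ.* + 1      ∎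
    lucas-digits interior u       (suc v) v<P = subst (_Matches digits u (suc v)) (sym (+-suc (u * P) v))
      (pascal-step (lucas-digits interior u v (<-trans (n<1+n v) v<P)) ≈-refl inner carry)
      where
        inner : ∀ s t → suc t < P → digits u (suc v) s (suc t) ≈ digits u v s t ℤ.+ digits u v s (suc t)
        inner s t _ = ≈-reflexive (trans (cong (+ (u C s) ℤ.*_) (pascal v t)) (ℤ.*-distribˡ-+ (+ (u C s)) _ _))
        carry : ∀ s → digits u (suc v) (suc s) 0 ≈ digits u v s P′ ℤ.+ digits u v (suc s) 0
        carry s = begin
          + (u C suc s) ℤ.* + 1                                   ≡⟨ ℤ.+-identityˡ _ ⟨
          + 0 ℤ.+ + (u C suc s) ℤ.* + 1                           ≡⟨ cong (ℤ._+ (+ (u C suc s) ℤ.* + 1)) (ℤ.*-zeroʳ (+ (u C s))) ⟨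
          + (u C s) ℤ.* + 0 ℤ.+ + (u C suc s) ℤ.* + 1             ≡⟨ cong (λ x → + (u C s) ℤ.* + x ℤ.+ _) (k>n⇒nCk≡0 (≤-pred v<P)) ⟨
          + (u C s) ℤ.* + (v C P′) ℤ.+ + (u C suc s) ℤ.* + 1      ∎

  lucas : ∀ {P} → InteriorVanishes P → ∀ u v s t → v < P → t < P →
          + ((u * P + v) C (s * P + t)) ≈ + (u C s) ℤ.* + (v C t)
  lucas {suc P′} interior u v s t v<P t<P = Digits.lucas-digits interior u v v<P s t t<P

-- Frobenius, Fermat and signs modulo a prime

-- p is written 2 + n so that p ∸ 1 and p ∸ 2 compute to suc n and n.
module PrimeModulus (n : ℕ) (p-prime : Prime (2 + n)) where

  p : ℕ
  p = 2 + n

  open ModularIntegers p public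
  open import Relation.Binary.Reasoning.Setoid setoid
  open import Algebra.Properties.CommutativeSemiring.Binomial commutativeSemiring
    using (theorem; binomialExpansion; binomialTerm)
  open import Algebra.Properties.Monoid.Mult +-monoid using (×-homo-1) renaming (_×_ to _·_)
  open import Algebra.Properties.Semiring.Exp semiring using () renaming (_^_ to _^ᴿ_)
  open import Algebra.Properties.Group +-group using (inverseʳ-unique)

  ^ᴿ≡^ : ∀ x k → x ^ᴿ k ≡ x ℤ.^ k
  ^ᴿ≡^ x zero    = refl
  ^ᴿ≡^ x (suc k) = cong (ℤ._*_ x) (^ᴿ≡^ x k)

  frobenius : ∀ x y → (x ℤ.+ y) ℤ.^ p ≈ x ℤ.^ p ℤ.+ y ℤ.^ p
  frobenius x y = begin
    (x ℤ.+ y) ℤ.^ p                                                ≡⟨ ^ᴿ≡^ (x ℤ.+ y) p ⟨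
    (x ℤ.+ y) ^ᴿ p                                                 ≈⟨ theorem p x y ⟩
    binomialExpansion x y p                                        ≈⟨ sum-ends (binomialTerm x y p) inner≈0 ⟩
    binomialTerm x y p Fin.zero ℤ.+ binomialTerm x y p (fromℕ p)   ≈⟨ +-cong first last ⟩
    y ℤ.^ p ℤ.+ x ℤ.^ p                                            ≡⟨ ℤ.+-comm (y ℤ.^ p) (x ℤ.^ p) ⟩
    x ℤ.^ p ℤ.+ y ℤ.^ p                                            ∎
    where
      inner≈0 : ∀ i → binomialTerm x y p (Fin.suc (inject₁ i)) ≈ + 0
      inner≈0 i = ∣⇒·≈0 (prime∣pCk p-prime (s≤s z≤n) (s≤s (Fin.inject₁ℕ< i))) _
      first : binomialTerm x y p Fin.zero ≈ y ℤ.^ p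
      first = ≈-trans (×-homo-1 _) (≈-reflexive (trans (ℤ.*-identityˡ _) (^ᴿ≡^ y p)))
      last : binomialTerm x y p (fromℕ p) ≈ x ℤ.^ p
      last = begin
        binomialTerm x y p (fromℕ p)          ≡⟨ cong (λ k → (p C k) · (x ^ᴿ k ℤ.* y ^ᴿ (p ∸ k))) (Fin.toℕ-fromℕ p) ⟩
        (p C p) · (x ^ᴿ p ℤ.* y ^ᴿ (p ∸ p))   ≡⟨ cong₂ (λ c e → c · (x ^ᴿ p ℤ.* y ^ᴿ e)) (nCn≡1 p) (n∸n≡0 p) ⟩
        1 · (x ^ᴿ p ℤ.* + 1)                  ≈⟨ ×-homo-1 _ ⟩
        x ^ᴿ p ℤ.* + 1                        ≡⟨ trans (ℤ.*-identityʳ _) (^ᴿ≡^ x p) ⟩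
        x ℤ.^ p                               ∎

  [+m]^p≈+m : ∀ m → (+ m) ℤ.^ p ≈ + m
  [+m]^p≈+m zero    = ≈-refl
  [+m]^p≈+m (suc m) = begin
    (+ 1 ℤ.+ + m) ℤ.^ p            ≈⟨ frobenius (+ 1) (+ m) ⟩
    (+ 1) ℤ.^ p ℤ.+ (+ m) ℤ.^ p    ≈⟨ +-cong (≈-reflexive (ℤ.^-zeroˡ p)) ([+m]^p≈+m m) ⟩
    + 1 ℤ.+ + m                    ∎

  private
    factor : ∀ x y z → x ℤ.* y ℤ.- x ℤ.* z ≡ x ℤ.* (y ℤ.- z)
    factor = ℤ.solve-∀

  *-cancelˡ-≈ : ∀ {x y z} → ¬ p ∣ ∣ x ∣ → x ℤ.* y ≈ x ℤ.* z → y ≈ z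
  *-cancelˡ-≈ {x} {y} {z} p∤x (by-divisibility p∣xy-xz)
    with euclidsLemma ∣ x ∣ ∣ y ℤ.- z ∣ p-prime
           (subst (p ∣_) (ℤ.abs-* x (y ℤ.- z)) (Signed.∣⇒∣ᵤ (subst (+ p Signed.∣_) (factor x y z) p∣xy-xz)))
  ... | inj₁ p∣x   = contradiction p∣x p∤x
  ... | inj₂ p∣y-z = by-divisibility (Signed.∣ᵤ⇒∣ p∣y-z)

  fermat : ∀ {m} → ¬ p ∣ m → (+ m) ℤ.^ suc n ≈ + 1
  fermat {m} p∤m = *-cancelˡ-≈ {+ m} p∤m (begin
    (+ m) ℤ.^ p    ≈⟨ [+m]^p≈+m m ⟩
    + m            ≡⟨ ℤ.*-identityʳ (+ m) ⟨
    + m ℤ.* + 1    ∎)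

  [-1]^[p∸1]≈1 : -1ℤ ℤ.^ suc n ≈ + 1
  [-1]^[p∸1]≈1 = *-cancelˡ-≈ { -1ℤ} p∤1 (inverseʳ-unique (+ 1) (-1ℤ ℤ.^ p) (begin
    + 1 ℤ.+ -1ℤ ℤ.^ p            ≡⟨ cong (ℤ._+ -1ℤ ℤ.^ p) (ℤ.^-zeroˡ p) ⟨
    (+ 1) ℤ.^ p ℤ.+ -1ℤ ℤ.^ p    ≈⟨ ≈-sym (frobenius (+ 1) -1ℤ) ⟩
    + 0                          ∎))
    where
      p∤1 : ¬ p ∣ 1
      p∤1 p∣1 with ∣1⇒≡1 p∣1
      ... | ()

  [-1]^-cong : ∀ {i j} → suc n ∣ i + j → -1ℤ ℤ.^ i ≈ -1ℤ ℤ.^ j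
  [-1]^-cong {i} {j} (divides q i+j≡q*[p∸1]) = begin
    -1ℤ ℤ.^ i                                   ≡⟨ ℤ.*-identityʳ _ ⟨
    -1ℤ ℤ.^ i ℤ.* + 1                           ≈⟨ *-cong (≈-refl { -1ℤ ℤ.^ i}) (≈-sym [-1]^[i+j]≈1) ⟩
    -1ℤ ℤ.^ i ℤ.* -1ℤ ℤ.^ (i + j)               ≡⟨ cong (-1ℤ ℤ.^ i ℤ.*_) (ℤ.^-distribˡ-+-* -1ℤ i j) ⟩
    -1ℤ ℤ.^ i ℤ.* (-1ℤ ℤ.^ i ℤ.* -1ℤ ℤ.^ j)     ≡⟨ ℤ.*-assoc (-1ℤ ℤ.^ i) (-1ℤ ℤ.^ i) (-1ℤ ℤ.^ j) ⟨
    -1ℤ ℤ.^ i ℤ.* -1ℤ ℤ.^ i ℤ.* -1ℤ ℤ.^ j       ≡⟨ cong (ℤ._* -1ℤ ℤ.^ j) ([-1]^i*[-1]^i≡1 i) ⟩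
    + 1 ℤ.* -1ℤ ℤ.^ j                           ≡⟨ ℤ.*-identityˡ _ ⟩
    -1ℤ ℤ.^ j                                   ∎
    where
      [-1]^[i+j]≈1 : -1ℤ ℤ.^ (i + j) ≈ + 1
      [-1]^[i+j]≈1 = begin
        -1ℤ ℤ.^ (i + j)              ≡⟨ cong (-1ℤ ℤ.^_) (trans i+j≡q*[p∸1] (*-comm q (suc n))) ⟩
        -1ℤ ℤ.^ (suc n * q)          ≡⟨ ℤ.^-*-assoc -1ℤ (suc n) q ⟨
        (-1ℤ ℤ.^ suc n) ℤ.^ q        ≈⟨ ^-congˡ q [-1]^[p∸1]≈1 ⟩
        (+ 1) ℤ.^ q                  ≡⟨ ℤ.^-zeroˡ q ⟩
        + 1                          ∎

  [p∸1]Ck≈[-1]^k : ∀ {k} → k < p → + (suc n C k) ≈ -1ℤ ℤ.^ k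
  [p∸1]Ck≈[-1]^k {zero}  _   = ≈-refl
  [p∸1]Ck≈[-1]^k {suc k} k<p = begin
    + (suc n C suc k)           ≈⟨ inverseʳ-unique (+ (suc n C k)) _ (begin
      + (suc n C k) ℤ.+ + (suc n C suc k) ≡⟨ pascal (suc n) k ⟨
      + (p C suc k)                       ≈⟨ ∣⇒≈0 (prime∣pCk p-prime (s≤s z≤n) k<p) ⟩
      + 0                                 ∎) ⟩
    ℤ.- + (suc n C k)           ≈⟨ -‿cong ([p∸1]Ck≈[-1]^k (<-trans (n<1+n k) k<p)) ⟩
    ℤ.- (-1ℤ ℤ.^ k)             ≡⟨ ℤ.-1*i≡-i _ ⟨
    -1ℤ ℤ.^ suc k               ∎

  [p∸2]Ci≈[-1]^i*[1+i] : ∀ {i} → i < suc n → + (n C i) ≈ -1ℤ ℤ.^ i ℤ.* + suc i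
  [p∸2]Ci≈[-1]^i*[1+i] {zero}  _      = ≈-refl
  [p∸2]Ci≈[-1]^i*[1+i] {suc i} 1+i<p-1 = begin
    + (n C suc i)                                        ≡⟨ y≡[x+y]-x (+ (n C i)) _ ⟩
    + (n C i) ℤ.+ + (n C suc i) ℤ.- + (n C i)            ≡⟨ cong (ℤ._- + (n C i)) (pascal n i) ⟨
    + (suc n C suc i) ℤ.- + (n C i)                      ≈⟨ +-cong ([p∸1]Ck≈[-1]^k (m<n⇒m<1+n 1+i<p-1))
                                                                   (-‿cong ([p∸2]Ci≈[-1]^i*[1+i] (<-trans (n<1+n i) 1+i<p-1))) ⟩
    -1ℤ ℤ.^ suc i ℤ.- -1ℤ ℤ.^ i ℤ.* + suc i              ≡⟨ collect (-1ℤ ℤ.^ i) (+ suc i) ⟩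
    -1ℤ ℤ.^ suc i ℤ.* + suc (suc i)                      ∎
    where
      y≡[x+y]-x : ∀ x y → y ≡ x ℤ.+ y ℤ.- x
      y≡[x+y]-x = ℤ.solve-∀
      collect : ∀ s x → -1ℤ ℤ.* s ℤ.- s ℤ.* x ≡ (-1ℤ ℤ.* s) ℤ.* (+ 1 ℤ.+ x)
      collect = ℤ.solve-∀

  p^m-interior-vanishes : ∀ m → InteriorVanishes (p ^ m)
  p^m-interior-vanishes zero    {suc t} _   (s≤s ())
  p^m-interior-vanishes (suc m) {t}     0<t t<p^[1+m] = ≈0⇒∣ (begin
    + (p ^ suc m C t)                           ≡⟨ cong₂ (λ x y → + (x C y)) (sym (+-identityʳ (p * P))) t≡t₁P+t₀ ⟩
    + ((p * P + 0) C (t₁ * P + t₀))             ≈⟨ lucas (p^m-interior-vanishes m) p 0 t₁ t₀ (m^n>0 p m) (m%n<n t P) ⟩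
    + (p C t₁) ℤ.* + (0 C t₀)                   ≈⟨ vanishes t₀ refl ⟩
    + 0                                         ∎)
    where
      P t₁ t₀ : ℕ
      P = p ^ m
      instance
        P≢0 : NonZero P
        P≢0 = m^n≢0 p m
      t₁ = t / P
      t₀ = t % P
      t≡t₁P+t₀ : t ≡ t₁ * P + t₀
      t≡t₁P+t₀ = trans (m≡m%n+[m/n]*n t P) (+-comm t₀ (t₁ * P))
      vanishes : ∀ r → r ≡ t₀ → + (p C t₁) ℤ.* + (0 C r) ≈ + 0
      vanishes (suc r) _      = ≈-reflexive (ℤ.*-zeroʳ (+ (p C t₁)))
      vanishes zero    0≡t₀   = begin
        + (p C t₁) ℤ.* + 1      ≈⟨ *-cong (∣⇒≈0 (prime∣pCk p-prime 0<t₁ t₁<p)) ≈-refl ⟩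
        + 0 ℤ.* + 1             ≡⟨⟩
        + 0                     ∎
        where
          t₁<p : t₁ < p
          t₁<p = m<n*o⇒m/o<n t<p^[1+m]
          0<t₁ : 0 < t₁
          0<t₁ = n≢0⇒n>0 λ t₁≡0 → <⇒≢ 0<t (sym (trans t≡t₁P+t₀ (cong₂ _+_ (cong (_* P) t₁≡0) (sym 0≡t₀))))

  binomial-digits : ∀ {m a j i} → 1 ≤ a → a ≤ p ^ m → j < p ^ m →
                    + ((r p m ∸ a) C (j + i * p ^ m)) ≈ + (n C i) ℤ.* + ((p ^ m ∸ a) C j)
  binomial-digits {m} {a} {j} {i} 1≤a a≤P j<P = begin
    + ((r p m ∸ a) C (j + i * P))          ≡⟨ cong +_ (cong₂ _C_ r-a≡nP+[P-a] (+-comm j (i * P))) ⟩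
    + ((n * P + (P ∸ a)) C (i * P + j))    ≈⟨ lucas (p^m-interior-vanishes m) n (P ∸ a) i j (∸-monoʳ-< 1≤a a≤P) j<P ⟩
    + (n C i) ℤ.* + ((P ∸ a) C j)          ∎
    where
      P : ℕ
      P = p ^ m
      r-a≡nP+[P-a] : r p m ∸ a ≡ n * P + (P ∸ a)
      r-a≡nP+[P-a] = trans (+-∸-comm (n * P) a≤P) (+-comm (P ∸ a) (n * P))

  binomial-congruence : ∀ {m a j i} → 1 ≤ a → a ≤ p ^ m → 1 ≤ j → j ≤ p ^ m ∸ a → i < suc n →
                        suc n ∣ j + i * p ^ m →
                        + (invMod p (ceilDiv (j + i * p ^ m) (jmax p m a)) * ((r p m ∸ a) C (j + i * p ^ m)))
                          ≈ f p m a j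
  binomial-congruence {m} {a} {j} {i} 1≤a a≤P 1≤j j≤P∸a i<p-1 p-1∣N = begin
    + (invMod p (ceilDiv N (jmax p m a)) * B)
      ≡⟨ cong (λ K → + (K ^ n * B)) (ceilDiv-jmax {n} {m} {a} {j} {i} 1≤a a≤P 1≤j j≤P∸a i<p-1 p-1∣N) ⟩
    + (suc i ^ n * B)
      ≡⟨ trans (ℤ.pos-* (suc i ^ n) B) (cong (ℤ._* + B) (pos-^ (suc i) n)) ⟩
    (+ suc i) ℤ.^ n ℤ.* + B
      ≈⟨ *-cong (≈-refl {(+ suc i) ℤ.^ n}) (binomial-digits {m} {a} {j} {i} 1≤a a≤P j<P) ⟩
    (+ suc i) ℤ.^ n ℤ.* (+ (n C i) ℤ.* X)
      ≈⟨ *-cong (≈-refl {(+ suc i) ℤ.^ n}) (*-cong ([p∸2]Ci≈[-1]^i*[1+i] i<p-1) (≈-refl {X})) ⟩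
    (+ suc i) ℤ.^ n ℤ.* (-1ℤ ℤ.^ i ℤ.* + suc i ℤ.* X)
      ≡⟨ regroup ((+ suc i) ℤ.^ n) (-1ℤ ℤ.^ i) (+ suc i) X ⟩
    -1ℤ ℤ.^ i ℤ.* X ℤ.* (+ suc i ℤ.* (+ suc i) ℤ.^ n)
      ≈⟨ *-cong (≈-refl { -1ℤ ℤ.^ i ℤ.* X}) (fermat p∤1+i) ⟩
    -1ℤ ℤ.^ i ℤ.* X ℤ.* + 1
      ≡⟨ ℤ.*-identityʳ (-1ℤ ℤ.^ i ℤ.* X) ⟩
    -1ℤ ℤ.^ i ℤ.* X
      ≈⟨ *-cong ([-1]^-cong {i} {j} p-1∣i+j) (≈-refl {X}) ⟩
    -1ℤ ℤ.^ j ℤ.* X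
      ∎
    where
      N B : ℕ
      N = j + i * p ^ m
      B = (r p m ∸ a) C N
      X : ℤ
      X = + ((p ^ m ∸ a) C j)
      j<P : j < p ^ m
      j<P = ≤-<-trans j≤P∸a (∸-monoʳ-< 1≤a a≤P)
      p∤1+i : ¬ p ∣ suc i
      p∤1+i p∣1+i = <⇒≱ (s≤s i<p-1) (∣⇒≤ p∣1+i)
      p-1∣i+j : suc n ∣ i + j
      p-1∣i+j = ∣j+i*P⇒∣i+j {i = i} {j} (proj₂ ([2+k]^m≡1+[1+k]*Q n m)) p-1∣N
      regroup : ∀ y s x X → y ℤ.* (s ℤ.* x ℤ.* X) ≡ s ℤ.* X ℤ.* (x ℤ.* y)
      regroup = ℤ.solve-∀

c-at-multiple : ∀ {p m a l N} → 1 ≤ N → l * (p ∸ 1) ≡ N →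
                c p m a l ≡ + (invMod p (ceilDiv N (jmax p m a)) * ((r p m ∸ a) C N))
c-at-multiple {l = zero}  1≤N 0≡N = contradiction 0≡N (<⇒≢ 1≤N)
c-at-multiple {l = suc l} _   refl = refl

proposition5p9 :
    (p : ℕ) → Prime p →
    (a : ℕ) → 1 ≤ a →
    (m : ℕ) → a ≤ p ^ m → (∀ k → a ≤ p ^ k → m ≤ k) →
    (j : ℕ) → 1 ≤ j → j ≤ p ^ m ∸ a →
    (i : ℕ) → i < p ∸ 1 → (p ∸ 1) ∣ (j + i * p ^ m) →
    (l : ℕ) → l * (p ∸ 1) ≡ j + i * p ^ m →
    (f p m a j ≡ (+ (invMod p (ceilDiv (j + i * p ^ m) (jmax p m a))
                      * ((r p m ∸ a) C (j + i * p ^ m)))) [mod p ])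
    × ((+ (invMod p (ceilDiv (j + i * p ^ m) (jmax p m a))
             * ((r p m ∸ a) C (j + i * p ^ m)))) ≡ c p m a l [mod p ])
proposition5p9 zero          p-prime = ⊥-elim (¬prime[0] p-prime)
proposition5p9 (suc zero)    p-prime = ⊥-elim (¬prime[1] p-prime)
proposition5p9 (suc (suc n)) p-prime a 1≤a m a≤P _ j 1≤j j≤P∸a i i<p-1 p-1∣N l l[p-1]≡N =
    ≈⇒≡[mod] (≈-sym (binomial-congruence {m} {a} {j} {i} 1≤a a≤P 1≤j j≤P∸a i<p-1 p-1∣N))
  , ≈⇒≡[mod] (≈-reflexive (sym (c-at-multiple {suc (suc n)} {m} {a} {l} (≤-trans 1≤j (m≤m+n j _)) l[p-1]≡N)))
  where open PrimeModulus n p-prime
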